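{- For each integer $n\ge 1$ let $\rho_6(n)$ denote the number of partitions of $n$ in which the largest part $\ell$ appears exactly once, each remaining part is congruent to $1$ or $5$ modulo $6$ (repetitions allowed), and the remaining parts (all strictly smaller than $\ell$) form a partition of $\ell$ (no congruence condition is imposed on $\ell$). Then for every $n\ge1$, $\rho_6(n)$ equals the coefficient of $q^n$ in $$\frac{1}{(q^2,q^{10};q^{12})_{\infty}}-\frac{q^2+q^{10}}{1-q^{12}}.$$
   Context: A partition of a positive integer $n$ is a way of writing $n$ as a sum of positive integers (parts), listed in non-increasing order. For $|q|<1$, $(t;q)_0=1$, $(t;q)_n=(1-t)(1-tq)\cdots(1-tq^{n-1})$ for $n>0$, $(t;q)_\infty=\lim_{n\to\infty}(t;q)_n$, and $(a,b;q)_\infty=(a;q)_\infty(b;q)_\infty$. -}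

module Defs where

open import Data.Nat using (ℕ; zero; suc; _+_; _*_; _∸_; _≤_; _<_; _≥_; _%_)
open import Data.Nat.Divisibility using (_∣?_)
open import Data.Integer using (ℤ; +_; _-_) renaming (_+_ to _+ℤ_; _*_ to _*ℤ_)
open import Data.List using (List; []; _∷_; map; upTo)
open import Data.Nat.ListAction using (sum)
open import Data.List.Relation.Unary.All using (All)
open import Data.List.Relation.Unary.Linked using (Linked)
open import Data.Product using (Σ; _×_)
open import Data.Sum using (_⊎_)
open import Data.Empty using (⊥)
open import Relation.Nullary.Decidable using (does)
open import Data.Bool using (if_then_else_)
open import Relation.Binary.PropositionalEquality using (_≡_)

-- Formal power series in q with integer coefficients: n ↦ coeff of q^n

Series : Set
Series = ℕ → ℤ

one : Series
one zero    = + 1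
one (suc _) = + 0

mono : ℕ → Series
mono k n = if does (n Data.Nat.≟ k) then + 1 else + 0

_⊕_ : Series → Series → Series
(f ⊕ g) n = f n +ℤ g n

_⊖_ : Series → Series → Series
(f ⊖ g) n = f n - g n

_⊛_ : Series → Series → Series
(f ⊛ g) n = Data.List.foldr _+ℤ_ (+ 0) (map (λ i → f i *ℤ g (n ∸ i)) (upTo (suc n)))

-- expansion of 1/(1 - q^k) = Σ_{m≥0} q^{k m}   (used with k ≥ 1)
geom : ℕ → Series
geom k n = if does (k ∣? n) then + 1 else + 0

invPoch2Trunc : ℕ → ℕ → ℕ → ℕ → Series
invPoch2Trunc a b m zero    = one
invPoch2Trunc a b m (suc J) =
  (invPoch2Trunc a b m J ⊛ geom (a + m * J)) ⊛ geom (b + m * J)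

-- 1/(q^a, q^b; q^m)_∞ = ∏_{j ≥ 0} 1/((1 - q^{a+mj})(1 - q^{b+mj})).
-- For m ≥ 1, factors with j > n are ≡ 1 mod q^{n+1}, so the coefficient of
-- q^n is that of the finite product over j ≤ n.
invPoch2 : ℕ → ℕ → ℕ → Series
invPoch2 a b m n = invPoch2Trunc a b m (suc n) n

rhs6 : Series
rhs6 = invPoch2 2 10 12 ⊖ ((mono 2 ⊕ mono 10) ⊛ geom 12)

record IsPartition (n : ℕ) (xs : List ℕ) : Set where
  field
    nonincreasing : Linked _≥_ xs
    positive      : All (λ p → 1 ≤ p) xs
    sums          : sum xs ≡ n

Rho6Shape : List ℕ → Set
Rho6Shape []         = ⊥
Rho6Shape (ℓ ∷ rest) =
  All (λ p → p < ℓ) rest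
  × All (λ p → p % 6 ≡ 1 ⊎ p % 6 ≡ 5) rest
  × sum rest ≡ ℓ

Rho6 : ℕ → Set
Rho6 n = Σ (List ℕ) (λ xs → IsPartition n xs × Rho6Shape xs)

-- A ρ₆-partition ℓ + p₁ + … + p_r of n with p₁ + … + p_r = ℓ is determined by its tail, i.e. by the partition
-- 2p₁ + … + 2p_r of n into parts twice a unit mod 6; conversely such a partition is the tail of a ρ₆-partition
-- (with ℓ = n/2) exactly when r ≥ 2, since r = 1 would give p₁ = ℓ. All these partitions of n are counted by
-- ∏_{p ≡ ±1 (6)} 1/(1 - q^{2p}) = 1/(q²,q¹⁰;q¹²)_∞, those with r = 1 by (q² + q¹⁰)/(1 - q¹²).

module Submission where

open import Defs
open import Data.Bool using (Bool; true; false; T; _∧_; if_then_else_)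
open import Data.Bool.Properties using (T-irrelevant; T-∧)
open import Data.Empty using (⊥-elim)
open import Data.Fin using (Fin; punchIn; punchOut)
import Data.Fin.Properties as FinP
open import Data.Integer using (ℤ; +_; _-_) renaming (_+_ to _+ℤ_; _*_ to _*ℤ_)
import Data.Integer.Properties as ℤP
open import Data.List using (List; []; _∷_; map; applyUpTo; foldr)
open import Data.List.Relation.Unary.All as All using (All; []; _∷_)
open import Data.List.Relation.Unary.Linked as Linked using (Linked; [-]; _∷_)
open import Data.List.Relation.Unary.Linked.Properties using (Linked⇒All)
open import Data.Nat using (ℕ; zero; suc; _+_; _*_; _∸_; _≤_; _<_; _≥_; _%_; _/_; z≤n; s≤s; _≡ᵇ_; _≟_; _≤?_)
open import Data.Nat.Divisibility using (_∣_; _∣?_; ∣m+n∣m⇒∣n; ∣m∣n⇒∣m+n; ∣-refl; >⇒∤; divides-refl; m%n≡0⇒n∣m)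
open import Data.Nat.DivMod using ([m+kn]%n≡m%n; +-distrib-/-∣ˡ; m*n/n≡m; m*n%n≡0; m*[n/m]≡n)
open import Data.Nat.Induction using (<-rec)
open import Data.Nat.ListAction using (sum)
import Data.Nat.Properties as ℕP
open import Data.Nat.Solver using (module +-*-Solver)
open import Data.Product using (Σ; _×_; _,_; proj₁; proj₂)
open import Data.Sum using (_⊎_; inj₁; inj₂)
open import Data.Sum.Properties using (inj₂-injective)
open import Data.Sum.Algebra using (⊎-assoc)
open import Data.Sum.Function.Propositional using (_⊎-↔_)
open import Function using (_∘_; id)
open import Function.Bundles using (_↔_; mk↔ₛ′; Inverse; Equivalence)
open import Function.Properties.Inverse using (↔-trans; ↔-sym; ↔-refl)
open import Level using (0ℓ)
open import Relation.Nullary using (¬_; Dec; isYes; yes; no)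
open import Relation.Nullary.Decidable using (dec-true; dec-false; T?; toWitness; fromWitness; _⊎-dec_)
open import Relation.Nullary.Irrelevant using (Irrelevant)
open import Relation.Binary.PropositionalEquality

sum< : (ℕ → ℤ) → ℕ → ℤ
sum< g zero    = + 0
sum< g (suc n) = sum< g n +ℤ g n

sum<-unfoldˡ : ∀ g n → sum< g (suc n) ≡ g 0 +ℤ sum< (g ∘ suc) n
sum<-unfoldˡ g zero    = ℤP.+-comm (+ 0) (g 0)
sum<-unfoldˡ g (suc n) = trans (cong (_+ℤ g (suc n)) (sum<-unfoldˡ g n)) (ℤP.+-assoc (g 0) _ _)

foldr-map-applyUpTo : ∀ (h : ℕ → ℤ) f n →
  foldr _+ℤ_ (+ 0) (map h (applyUpTo f n)) ≡ sum< (h ∘ f) n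
foldr-map-applyUpTo h f zero    = refl
foldr-map-applyUpTo h f (suc n) =
  trans (cong (h (f 0) +ℤ_) (foldr-map-applyUpTo h (f ∘ suc) n)) (sym (sum<-unfoldˡ (h ∘ f) n))

⊛-sum< : ∀ F G n → (F ⊛ G) n ≡ sum< (λ i → F i *ℤ G (n ∸ i)) (suc n)
⊛-sum< F G n = foldr-map-applyUpTo (λ i → F i *ℤ G (n ∸ i)) id (suc n)

sum<-cong : ∀ {g h} n → (∀ i → i < n → g i ≡ h i) → sum< g n ≡ sum< h n
sum<-cong zero    g≡h = refl
sum<-cong (suc n) g≡h =
  cong₂ _+ℤ_ (sum<-cong n (λ i i<n → g≡h i (ℕP.m<n⇒m<1+n i<n))) (g≡h n ℕP.≤-refl)

sum<-zero : ∀ g n → (∀ i → i < n → g i ≡ + 0) → sum< g n ≡ + 0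
sum<-zero g zero    g≡0 = refl
sum<-zero g (suc n) g≡0 =
  cong₂ _+ℤ_ (sum<-zero g n (λ i i<n → g≡0 i (ℕP.m<n⇒m<1+n i<n))) (g≡0 n ℕP.≤-refl)

sum<-vanishingTail : ∀ g m k → (∀ i → m ≤ i → i < k + m → g i ≡ + 0) → sum< g (k + m) ≡ sum< g m
sum<-vanishingTail g m zero    g≡0 = refl
sum<-vanishingTail g m (suc k) g≡0 = trans
  (cong₂ _+ℤ_ (sum<-vanishingTail g m k (λ i m≤i i<k+m → g≡0 i m≤i (ℕP.m<n⇒m<1+n i<k+m)))
              (g≡0 (k + m) (ℕP.m≤n+m m k) ℕP.≤-refl))
  (ℤP.+-identityʳ _)

⊛-cong : ∀ {f f′ g g′ : Series} → (∀ i → f i ≡ f′ i) → (∀ i → g i ≡ g′ i) → ∀ n → (f ⊛ g) n ≡ (f′ ⊛ g′) n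
⊛-cong {f} {f′} {g} {g′} f≡f′ g≡g′ n = begin
  (f ⊛ g) n                                   ≡⟨ ⊛-sum< f g n ⟩
  sum< (λ i → f i *ℤ g (n ∸ i)) (suc n)       ≡⟨ sum<-cong (suc n) (λ i _ → cong₂ _*ℤ_ (f≡f′ i) (g≡g′ (n ∸ i))) ⟩
  sum< (λ i → f′ i *ℤ g′ (n ∸ i)) (suc n)     ≡⟨ ⊛-sum< f′ g′ n ⟨
  (f′ ⊛ g′) n                                 ∎
  where open ≡-Reasoning

geom-∣ : ∀ {d n} → d ∣ n → geom d n ≡ + 1
geom-∣ {d} {n} d∣n = cong (if_then + 1 else + 0) (dec-true (d ∣? n) d∣n)

geom-∤ : ∀ {d n} → ¬ d ∣ n → geom d n ≡ + 0
geom-∤ {d} {n} d∤n = cong (if_then + 1 else + 0) (dec-false (d ∣? n) d∤n)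

geom-periodic : ∀ d x → geom (suc d) (x + suc d) ≡ geom (suc d) x
geom-periodic d x with suc d ∣? x
... | yes d∣x = trans (geom-∣ (∣m∣n⇒∣m+n d∣x ∣-refl)) (sym (geom-∣ d∣x))
... | no  d∤x = trans (geom-∤ (d∤x ∘ d∣x+d⇒d∣x)) (sym (geom-∤ d∤x))
  where
  d∣x+d⇒d∣x : suc d ∣ x + suc d → suc d ∣ x
  d∣x+d⇒d∣x d∣x+d = ∣m+n∣m⇒∣n (subst (suc d ∣_) (ℕP.+-comm x (suc d)) d∣x+d) ∣-refl

geom-between : ∀ d x → 0 < x → x < suc d → geom (suc d) x ≡ + 0
geom-between d x@(suc _) _ x<d = geom-∤ (>⇒∤ x<d)

⊛geom-last : ∀ F d n →
  (F ⊛ geom (suc d)) n ≡ sum< (λ i → F i *ℤ geom (suc d) (n ∸ i)) n +ℤ F n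
⊛geom-last F d n = trans (⊛-sum< F (geom (suc d)) n) (cong (sum< (λ i → F i *ℤ geom (suc d) (n ∸ i)) n +ℤ_) lastTerm)
  where
  lastTerm : F n *ℤ geom (suc d) (n ∸ n) ≡ F n
  lastTerm = trans (cong (λ x → F n *ℤ geom (suc d) x) (ℕP.n∸n≡0 n)) (ℤP.*-identityʳ (F n))

⊛geom-< : ∀ F d n → n < suc d → (F ⊛ geom (suc d)) n ≡ F n
⊛geom-< F d n n<d = begin
  (F ⊛ geom (suc d)) n                              ≡⟨ ⊛geom-last F d n ⟩
  sum< (λ i → F i *ℤ geom (suc d) (n ∸ i)) n +ℤ F n  ≡⟨ cong (_+ℤ F n) (sum<-zero _ n vanish) ⟩
  + 0 +ℤ F n                                        ≡⟨ ℤP.+-identityˡ (F n) ⟩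
  F n                                               ∎
  where
  open ≡-Reasoning
  vanish : ∀ i → i < n → F i *ℤ geom (suc d) (n ∸ i) ≡ + 0
  vanish i i<n = trans
    (cong (F i *ℤ_) (geom-between d (n ∸ i) (ℕP.m<n⇒0<n∸m i<n) (ℕP.≤-<-trans (ℕP.m∸n≤m n i) n<d)))
    (ℤP.*-zeroʳ (F i))

-- Besides the last term i = m + d, only the terms i ≤ m contribute, and for them geom (m + d - i) = geom (m - i).
⊛geom-+ : ∀ F d m → (F ⊛ geom (suc d)) (m + suc d) ≡ F (m + suc d) +ℤ (F ⊛ geom (suc d)) m
⊛geom-+ F d m = begin
  (F ⊛ geom (suc d)) n                   ≡⟨ ⊛geom-last F d n ⟩
  sum< t n +ℤ F n                        ≡⟨ cong (λ k → sum< t k +ℤ F n) n≡d+[1+m] ⟩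
  sum< t (d + suc m) +ℤ F n              ≡⟨ cong (_+ℤ F n) (sum<-vanishingTail t (suc m) d tail≡0) ⟩
  sum< t (suc m) +ℤ F n                  ≡⟨ cong (_+ℤ F n) (sum<-cong (suc m) shift) ⟩
  sum< t′ (suc m) +ℤ F n                 ≡⟨ cong (_+ℤ F n) (⊛-sum< F (geom (suc d)) m) ⟨
  (F ⊛ geom (suc d)) m +ℤ F n            ≡⟨ ℤP.+-comm _ (F n) ⟩
  F n +ℤ (F ⊛ geom (suc d)) m            ∎
  where
  open ≡-Reasoning
  n = m + suc d
  t = λ i → F i *ℤ geom (suc d) (n ∸ i)
  t′ = λ i → F i *ℤ geom (suc d) (m ∸ i)
  n≡d+[1+m] : n ≡ d + suc m
  n≡d+[1+m] = trans (ℕP.+-suc m d) (trans (cong suc (ℕP.+-comm m d)) (sym (ℕP.+-suc d m)))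
  tail≡0 : ∀ i → suc m ≤ i → i < d + suc m → t i ≡ + 0
  tail≡0 i m<i i<n = trans (cong (F i *ℤ_) (geom-between d (n ∸ i) 0<n∸i n∸i<d)) (ℤP.*-zeroʳ (F i))
    where
    0<n∸i = ℕP.m<n⇒0<n∸m (subst (i <_) (sym n≡d+[1+m]) i<n)
    n∸i<d = ℕP.≤-<-trans (ℕP.∸-monoʳ-≤ n m<i) (s≤s (ℕP.≤-reflexive (trans (cong (_∸ suc m) (ℕP.+-suc m d)) (ℕP.m+n∸m≡n m d))))
  shift : ∀ i → i < suc m → t i ≡ t′ i
  shift i (s≤s i≤m) = cong (F i *ℤ_) (trans (cong (geom (suc d)) (ℕP.+-∸-comm (suc d) i≤m)) (geom-periodic d (m ∸ i)))

⊛geom-≥ : ∀ F d n → suc d ≤ n → (F ⊛ geom (suc d)) n ≡ F n +ℤ (F ⊛ geom (suc d)) (n ∸ suc d)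
⊛geom-≥ F d n d≤n =
  subst (λ k → (F ⊛ geom (suc d)) k ≡ F k +ℤ (F ⊛ geom (suc d)) (n ∸ suc d))
        (ℕP.m∸n+n≡m d≤n) (⊛geom-+ F d (n ∸ suc d))

Counts : ℤ → Set → Set
Counts z A = Σ ℕ λ k → (z ≡ + k) × (A ↔ Fin k)

Counts-cast : ∀ {z w A} → z ≡ w → Counts z A → Counts w A
Counts-cast refl c = c

Counts-↔ : ∀ {z A B} → A ↔ B → Counts z A → Counts z B
Counts-↔ A↔B (k , z≡k , A↔k) = k , z≡k , ↔-trans (↔-sym A↔B) A↔k

Counts-∅ : ∀ {A} → ¬ A → Counts (+ 0) A
Counts-∅ ¬a = 0 , refl , mk↔ₛ′ (⊥-elim ∘ ¬a) (λ ()) (λ ()) (⊥-elim ∘ ¬a)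

Counts-prop : ∀ {A} b → Irrelevant A → (T b → A) → (A → T b) → Counts (+ (if b then 1 else 0)) A
Counts-prop true  irr a _ = 1 , refl , mk↔ₛ′ (λ _ → Fin.zero) (λ _ → a _) (λ { Fin.zero → refl ; (Fin.suc ()) }) (irr _)
Counts-prop false irr _ b = Counts-∅ b

Counts-⊎ : ∀ {z w A B} → Counts z A → Counts w B → Counts (z +ℤ w) (A ⊎ B)
Counts-⊎ (k , z≡k , A↔k) (l , w≡l , B↔l) =
  k + l , cong₂ _+ℤ_ z≡k w≡l , ↔-trans (A↔k ⊎-↔ B↔l) (↔-sym FinP.+↔⊎)

-- Removing the image of the extra point from Fin (1 + K) and renumbering by punchOut.
Fin1-⊎-cancel : ∀ {A : Set} K → (Fin 1 ⊎ A) ↔ Fin (suc K) → A ↔ Fin K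
Fin1-⊎-cancel {A} K f = mk↔ₛ′ to′ from′ to′∘from′ from′∘to′
  where
  open Inverse f
  p = to (inj₁ Fin.zero)
  p≢ : ∀ a → p ≢ to (inj₂ a)
  p≢ a eq with trans (sym (strictlyInverseʳ (inj₁ Fin.zero))) (trans (cong from eq) (strictlyInverseʳ (inj₂ a)))
  ... | ()
  fromInj₂ : (z : Fin 1 ⊎ A) → z ≢ inj₁ Fin.zero → A
  fromInj₂ (inj₁ Fin.zero) z≢ = ⊥-elim (z≢ refl)
  fromInj₂ (inj₂ a)        _  = a
  inj₂-fromInj₂ : ∀ z z≢ → inj₂ (fromInj₂ z z≢) ≡ z
  inj₂-fromInj₂ (inj₁ Fin.zero) z≢ = ⊥-elim (z≢ refl)
  inj₂-fromInj₂ (inj₂ a)        _  = refl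
  from-punchIn≢ : ∀ j → from (punchIn p j) ≢ inj₁ Fin.zero
  from-punchIn≢ j eq = FinP.punchInᵢ≢i p j (trans (sym (strictlyInverseˡ (punchIn p j))) (cong to eq))
  to′ : A → Fin K
  to′ a = punchOut (p≢ a)
  from′ : Fin K → A
  from′ j = fromInj₂ (from (punchIn p j)) (from-punchIn≢ j)
  to′∘from′ : ∀ j → to′ (from′ j) ≡ j
  to′∘from′ j = trans
    (FinP.punchOut-cong p (trans (cong to (inj₂-fromInj₂ _ (from-punchIn≢ j))) (strictlyInverseˡ (punchIn p j))))
    (FinP.punchOut-punchIn p)
  from′∘to′ : ∀ a → from′ (to′ a) ≡ a
  from′∘to′ a = inj₂-injective (trans (inj₂-fromInj₂ _ (from-punchIn≢ (to′ a)))
    (trans (cong from (FinP.punchIn-punchOut (p≢ a))) (strictlyInverseʳ (inj₂ a))))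

Fin-⊎-cancel : ∀ e {A : Set} {K} → (Fin e ⊎ A) ↔ Fin K → Σ ℕ λ k → (K ≡ e + k) × (A ↔ Fin k)
Fin-⊎-cancel zero    {A} {K} f = K , refl , ↔-trans A↔Fin0⊎A f
  where
  A↔Fin0⊎A : A ↔ (Fin 0 ⊎ A)
  A↔Fin0⊎A = mk↔ₛ′ inj₂ (λ { (inj₂ a) → a ; (inj₁ ()) }) (λ { (inj₂ a) → refl ; (inj₁ ()) }) (λ _ → refl)
Fin-⊎-cancel (suc e) {K = zero}  f = ⊥-elim (FinP.¬Fin0 (Inverse.to f (inj₁ Fin.zero)))
Fin-⊎-cancel (suc e) {A} {K = suc K} f =
  let k , K≡e+k , A↔k = Fin-⊎-cancel e (Fin1-⊎-cancel K (↔-trans reassoc f)) in k , cong suc K≡e+k , A↔k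
  where
  reassoc : (Fin 1 ⊎ (Fin e ⊎ A)) ↔ (Fin (suc e) ⊎ A)
  reassoc = ↔-trans (↔-sym (⊎-assoc 0ℓ (Fin 1) (Fin e) A)) (↔-sym (FinP.+↔⊎ {1} {e}) ⊎-↔ ↔-refl)

Counts-⊖ : ∀ {z w E A} → Counts z (E ⊎ A) → Counts w E → Counts (z - w) A
Counts-⊖ (K , z≡K , E⊎A↔K) (e , w≡e , E↔e) with Fin-⊎-cancel e (↔-trans (↔-sym E↔e ⊎-↔ ↔-refl) E⊎A↔K)
... | k , refl , A↔k = k , trans (cong₂ _-_ z≡K w≡e) [e+k]-e≡k , A↔k
  where
  [e+k]-e≡k : + (e + k) - + e ≡ + k
  [e+k]-e≡k = trans (ℤP.m-n≡m⊖n (e + k) e) (trans (ℤP.≤-⊖ (ℕP.m≤m+n e k)) (cong +_ (ℕP.m+n∸m≡n e k)))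

Linked-≥-headʳ : ∀ {B B′ ps} → B ≤ B′ → Linked _≥_ (B ∷ ps) → Linked _≥_ (B′ ∷ ps)
Linked-≥-headʳ B≤B′ [-]        = [-]
Linked-≥-headʳ B≤B′ (p≤B ∷ ps) = ℕP.≤-trans p≤B B≤B′ ∷ ps

×-identityˡ-Irrelevant : ∀ {P Z : Set} → Irrelevant P → P → (P × Z) ↔ Z
×-identityˡ-Irrelevant irr p = mk↔ₛ′ proj₂ (p ,_) (λ _ → refl) (λ (p′ , z) → cong (_, z) (irr p p′))

-- Parts B n: partitions of n into parts 2p with ok p and p ≤ B, stored as the non-increasing list of the p.
module EvenPartitions (ok : ℕ → Bool) (¬ok0 : ¬ T (ok 0)) where

  Parts : ℕ → ℕ → Set
  Parts B n = Σ (List ℕ) λ ps → Linked _≥_ (B ∷ ps) × All (T ∘ ok) ps × 2 * sum ps ≡ n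

  Parts-≡ : ∀ {B n} {a b : Parts B n} → proj₁ a ≡ proj₁ b → a ≡ b
  Parts-≡ {a = ps , l , o , e} {b = .ps , l′ , o′ , e′} refl
    with Linked.irrelevant ℕP.≤-irrelevant l l′ | All.irrelevant T-irrelevant o o′ | ℕP.≡-irrelevant e e′
  ... | refl | refl | refl = refl

  ok⇒positive : ∀ {p} → T (ok p) → 1 ≤ p
  ok⇒positive {zero}  o = ⊥-elim (¬ok0 o)
  ok⇒positive {suc p} _ = s≤s z≤n

  gen : ℕ → Series
  gen zero    = one
  gen (suc B) = if ok (suc B) then gen B ⊛ geom (2 * suc B) else gen B

  gen-ok : ∀ B → T (ok (suc B)) → ∀ n → gen (suc B) n ≡ (gen B ⊛ geom (2 * suc B)) n
  gen-ok B o n with ok (suc B)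
  ... | true = refl

  gen-¬ok : ∀ B → ¬ T (ok (suc B)) → ∀ n → gen (suc B) n ≡ gen B n
  gen-¬ok B ¬o n with ok (suc B)
  ... | true  = ⊥-elim (¬o _)
  ... | false = refl

  Parts0-[] : ∀ {n} (a : Parts 0 n) → proj₁ a ≡ []
  Parts0-[] ([] , _)                    = refl
  Parts0-[] (_ ∷ _ , z≤n ∷ _ , o ∷ _ , _) = ⊥-elim (¬ok0 o)

  count-0 : ∀ n → Counts (gen 0 n) (Parts 0 n)
  count-0 zero    = Counts-prop true (λ a b → Parts-≡ (trans (Parts0-[] a) (sym (Parts0-[] b))))
                                    (λ _ → [] , [-] , [] , refl) _
  count-0 (suc n) = Counts-∅ λ { ([] , _ , _ , ()) ; (_ ∷ _ , z≤n ∷ _ , o ∷ _ , _) → ¬ok0 o }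

  Parts-suc : ℕ → ℕ → Set
  Parts-suc B n = Parts B n ⊎ (T (ok (suc B)) × 2 * suc B ≤ n × Parts (suc B) (n ∸ 2 * suc B))

  Parts-split : ∀ B n → Parts (suc B) n ↔ Parts-suc B n
  Parts-split B n = mk↔ₛ′ split join split∘join join∘split
    where
    split : Parts (suc B) n → Parts-suc B n
    split ([] , _ , _ , e) = inj₁ ([] , [-] , [] , e)
    split (p ∷ ps , p≤1+B ∷ l , o ∷ os , e) with p ≟ suc B
    ... | yes refl = inj₂ (o , 2p≤n , ps , l , os , 2Σps≡n∸2p)
      where
      2p+2Σps≡n : 2 * p + 2 * sum ps ≡ n
      2p+2Σps≡n = trans (sym (ℕP.*-distribˡ-+ 2 p (sum ps))) e
      2p≤n : 2 * p ≤ n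
      2p≤n = subst (2 * p ≤_) 2p+2Σps≡n (ℕP.m≤m+n (2 * p) _)
      2Σps≡n∸2p : 2 * sum ps ≡ n ∸ 2 * p
      2Σps≡n∸2p = trans (sym (ℕP.m+n∸m≡n (2 * p) _)) (cong (_∸ 2 * p) 2p+2Σps≡n)
    ... | no p≢1+B = inj₁ (p ∷ ps , ℕP.≤-pred (ℕP.≤∧≢⇒< p≤1+B p≢1+B) ∷ l , o ∷ os , e)
    join : Parts-suc B n → Parts (suc B) n
    join (inj₁ (ps , l , os , e))            = ps , Linked-≥-headʳ (ℕP.n≤1+n B) l , os , e
    join (inj₂ (o , d≤n , ps , l , os , e)) = suc B ∷ ps , ℕP.≤-refl ∷ l , o ∷ os ,
      trans (ℕP.*-distribˡ-+ 2 (suc B) (sum ps)) (trans (cong (_+_ (2 * suc B)) e) (ℕP.m+[n∸m]≡n d≤n))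
    join∘split : ∀ a → join (split a) ≡ a
    join∘split ([] , _)                        = Parts-≡ refl
    join∘split (p ∷ ps , p≤1+B ∷ l , o ∷ os , e) with p ≟ suc B
    ... | yes refl = Parts-≡ refl
    ... | no _     = Parts-≡ refl
    split∘join : ∀ b → split (join b) ≡ b
    split∘join (inj₁ ([] , [-] , [] , e)) = refl
    split∘join (inj₁ (p ∷ ps , p≤B ∷ l , o ∷ os , e)) with p ≟ suc B
    ... | yes refl = ⊥-elim (ℕP.<-irrefl refl p≤B)
    ... | no _     = cong inj₁ (Parts-≡ refl)
    split∘join (inj₂ (o , d≤n , ps , l , os , e)) with suc B ≟ suc B
    ... | yes refl = cong inj₂ (cong₂ _,_ (T-irrelevant _ _) (cong₂ _,_ (ℕP.≤-irrelevant _ _) (Parts-≡ refl)))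
    ... | no ≢     = ⊥-elim (≢ refl)

  count-suc : ∀ B → (∀ n → Counts (gen B n) (Parts B n)) →
              ∀ n → (∀ {m} → m < n → Counts (gen (suc B) m) (Parts (suc B) m)) →
              Counts (gen (suc B) n) (Parts (suc B) n)
  count-suc B count-B n count-< = Counts-↔ (↔-sym (Parts-split B n)) count-split
    where
    count-split : Counts (gen (suc B) n) (Parts-suc B n)
    count-split with T? (ok (suc B)) | 2 * suc B ≤? n
    ... | no ¬o | _ =
      Counts-cast (trans (ℤP.+-identityʳ _) (sym (gen-¬ok B ¬o n)))
        (Counts-⊎ (count-B n) (Counts-∅ (¬o ∘ proj₁)))
    ... | yes o | no d≰n =
      Counts-cast (trans (ℤP.+-identityʳ _) (sym (trans (gen-ok B o n) (⊛geom-< (gen B) _ n (ℕP.≰⇒> d≰n)))))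
        (Counts-⊎ (count-B n) (Counts-∅ (d≰n ∘ proj₁ ∘ proj₂)))
    ... | yes o | yes d≤n =
      Counts-cast (sym (trans (gen-ok B o n) (trans (⊛geom-≥ (gen B) _ n d≤n) (cong (gen B n +ℤ_) (sym (gen-ok B o _))))))
        (Counts-⊎ (count-B n) (Counts-↔ (↔-sym dropConditions) (count-< (ℕP.∸-monoʳ-< (s≤s z≤n) d≤n))))
      where
      dropConditions : (T (ok (suc B)) × 2 * suc B ≤ n × Parts (suc B) (n ∸ 2 * suc B)) ↔ Parts (suc B) (n ∸ 2 * suc B)
      dropConditions = ↔-trans (×-identityˡ-Irrelevant T-irrelevant o) (×-identityˡ-Irrelevant ℕP.≤-irrelevant d≤n)

  count : ∀ B n → Counts (gen B n) (Parts B n)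
  count zero    = count-0
  count (suc B) = <-rec _ (count-suc B (count B))

IsUnit6 : ℕ → Set
IsUnit6 p = p % 6 ≡ 1 ⊎ p % 6 ≡ 5

unit6? : ∀ p → Dec (IsUnit6 p)
unit6? p = (p % 6 ≟ 1) ⊎-dec (p % 6 ≟ 5)

unit6 : ℕ → Bool
unit6 p = isYes (unit6? p)

IsUnit6-irrelevant : ∀ {p} → Irrelevant (IsUnit6 p)
IsUnit6-irrelevant (inj₁ a) (inj₁ b) = cong inj₁ (ℕP.≡-irrelevant a b)
IsUnit6-irrelevant (inj₂ a) (inj₂ b) = cong inj₂ (ℕP.≡-irrelevant a b)
IsUnit6-irrelevant (inj₁ a) (inj₂ b) with trans (sym a) b
... | ()
IsUnit6-irrelevant (inj₂ a) (inj₁ b) with trans (sym a) b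
... | ()

unit6-periodic : ∀ r J → unit6 (r + J * 6) ≡ unit6 r
unit6-periodic r J = cong (λ x → isYes ((x ≟ 1) ⊎-dec (x ≟ 5))) ([m+kn]%n≡m%n r J 6)

unit6-shift : ∀ r J → T (unit6 r) → T (unit6 (r + J * 6))
unit6-shift r J = subst T (sym (unit6-periodic r J))

¬unit6-shift : ∀ r J → ¬ T (unit6 r) → ¬ T (unit6 (r + J * 6))
¬unit6-shift r J ¬u = ¬u ∘ subst T (unit6-periodic r J)

open EvenPartitions unit6 (λ ())

-- Over each residue block 6J+1, …, 6J+6 only 6J+1 and 6J+5 are units, contributing q^(12J+2) and q^(12J+10).
invPoch2Trunc≡gen : ∀ J n → invPoch2Trunc 2 10 12 J n ≡ gen (J * 6) n
invPoch2Trunc≡gen zero    n = refl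
invPoch2Trunc≡gen (suc J) n = sym (begin
  gen (6 + J * 6) n                                           ≡⟨ gen-¬ok (5 + J * 6) (¬unit6-shift 6 J λ ()) n ⟩
  gen (5 + J * 6) n                                           ≡⟨ gen-ok (4 + J * 6) (unit6-shift 5 J _) n ⟩
  (gen (4 + J * 6) ⊛ geom (2 * (5 + J * 6))) n                ≡⟨ ⊛-cong gen-4≡gen-1 (geom-index (2*[5+6J]≡10+12J J)) n ⟩
  (gen (1 + J * 6) ⊛ geom (10 + 12 * J)) n                    ≡⟨ ⊛-cong {g = geom (10 + 12 * J)} gen-1≡ (λ _ → refl) n ⟩
  ((invPoch2Trunc 2 10 12 J ⊛ geom (2 + 12 * J)) ⊛ geom (10 + 12 * J)) n ∎)
  where
  open ≡-Reasoning
  open +-*-Solver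
  2*[1+6J]≡2+12J : ∀ J → 2 * (1 + J * 6) ≡ 2 + 12 * J
  2*[1+6J]≡2+12J = solve 1 (λ j → con 2 :* (con 1 :+ j :* con 6) := con 2 :+ con 12 :* j) refl
  2*[5+6J]≡10+12J : ∀ J → 2 * (5 + J * 6) ≡ 10 + 12 * J
  2*[5+6J]≡10+12J = solve 1 (λ j → con 2 :* (con 5 :+ j :* con 6) := con 10 :+ con 12 :* j) refl
  geom-index : ∀ {d d′} → d ≡ d′ → ∀ i → geom d i ≡ geom d′ i
  geom-index refl i = refl
  gen-4≡gen-1 : ∀ i → gen (4 + J * 6) i ≡ gen (1 + J * 6) i
  gen-4≡gen-1 i = trans (gen-¬ok (3 + J * 6) (¬unit6-shift 4 J λ ()) i)
                 (trans (gen-¬ok (2 + J * 6) (¬unit6-shift 3 J λ ()) i) (gen-¬ok (1 + J * 6) (¬unit6-shift 2 J λ ()) i))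
  gen-1≡ : ∀ i → gen (1 + J * 6) i ≡ (invPoch2Trunc 2 10 12 J ⊛ geom (2 + 12 * J)) i
  gen-1≡ i = trans (gen-ok (J * 6) (unit6-shift 1 J _) i)
                   (⊛-cong (λ k → sym (invPoch2Trunc≡gen J k)) (geom-index (2*[1+6J]≡2+12J J)) i)

twiceUnit6 : ℕ → Bool
twiceUnit6 n = (n % 2 ≡ᵇ 0) ∧ unit6 (n / 2)

twiceUnit6-periodic : ∀ m → twiceUnit6 (12 + m) ≡ twiceUnit6 m
twiceUnit6-periodic m = cong₂ _∧_
  (cong (_≡ᵇ 0) (trans (cong (_% 2) (ℕP.+-comm 12 m)) ([m+kn]%n≡m%n m 6 2)))
  (trans (cong unit6 half) (unit6-periodic (m / 2) 1))
  where
  half : (12 + m) / 2 ≡ m / 2 + 1 * 6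
  half = trans (+-distrib-/-∣ˡ {12} m {2} (divides-refl 6)) (ℕP.+-comm 6 (m / 2))

evenUnitSeries : Series
evenUnitSeries = (mono 2 ⊕ mono 10) ⊛ geom 12

evenUnitSeries-coeff : ∀ n → evenUnitSeries n ≡ + (if twiceUnit6 n then 1 else 0)
evenUnitSeries-coeff 0  = refl
evenUnitSeries-coeff 1  = refl
evenUnitSeries-coeff 2  = refl
evenUnitSeries-coeff 3  = refl
evenUnitSeries-coeff 4  = refl
evenUnitSeries-coeff 5  = refl
evenUnitSeries-coeff 6  = refl
evenUnitSeries-coeff 7  = refl
evenUnitSeries-coeff 8  = refl
evenUnitSeries-coeff 9  = refl
evenUnitSeries-coeff 10 = refl
evenUnitSeries-coeff 11 = refl
evenUnitSeries-coeff n@(suc (suc (suc (suc (suc (suc (suc (suc (suc (suc (suc (suc m)))))))))))) = begin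
  evenUnitSeries n                              ≡⟨ ⊛geom-≥ (mono 2 ⊕ mono 10) 11 n (ℕP.m≤m+n 12 m) ⟩
  + 0 +ℤ evenUnitSeries m                       ≡⟨ ℤP.+-identityˡ _ ⟩
  evenUnitSeries m                              ≡⟨ evenUnitSeries-coeff m ⟩
  + (if twiceUnit6 m then 1 else 0)             ≡⟨ cong (λ b → + (if b then 1 else 0)) (twiceUnit6-periodic m) ⟨
  + (if twiceUnit6 n then 1 else 0)             ∎
  where open ≡-Reasoning

SinglePart : ℕ → Set
SinglePart n = Σ ℕ λ p → T (unit6 p) × 2 * p ≡ n

SinglePart-≡ : ∀ {n} {a b : SinglePart n} → proj₁ a ≡ proj₁ b → a ≡ b
SinglePart-≡ {a = p , u , e} {b = .p , u′ , e′} refl = cong₂ (λ u e → p , u , e) (T-irrelevant u u′) (ℕP.≡-irrelevant e e′)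

count-SinglePart : ∀ n → Counts (evenUnitSeries n) (SinglePart n)
count-SinglePart n = Counts-cast (sym (evenUnitSeries-coeff n)) (Counts-prop (twiceUnit6 n) unique half twice)
  where
  unique : Irrelevant (SinglePart n)
  unique (p , _ , 2p≡n) (q , _ , 2q≡n) = SinglePart-≡ (ℕP.*-cancelˡ-≡ p q 2 (trans 2p≡n (sym 2q≡n)))
  half : T (twiceUnit6 n) → SinglePart n
  half t = let (even , u) = Equivalence.to T-∧ t in
    n / 2 , u , m*[n/m]≡n (m%n≡0⇒n∣m n 2 (ℕP.≡ᵇ⇒≡ (n % 2) 0 even))
  twice : SinglePart n → T (twiceUnit6 n)
  twice (p , u , refl) = Equivalence.from T-∧
    ( ℕP.≡⇒≡ᵇ _ 0 (trans (cong (_% 2) (ℕP.*-comm 2 p)) (m*n%n≡0 p 2))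
    , subst (T ∘ unit6) (sym (trans (cong (_/ 2) (ℕP.*-comm 2 p)) (m*n/n≡m p 2))) u )

IsPartition-irrelevant : ∀ {n xs} → Irrelevant (IsPartition n xs)
IsPartition-irrelevant record { nonincreasing = l ; positive = p ; sums = s } record { nonincreasing = l′ ; positive = p′ ; sums = s′ }
  with Linked.irrelevant ℕP.≤-irrelevant l l′ | All.irrelevant ℕP.≤-irrelevant p p′ | ℕP.≡-irrelevant s s′
... | refl | refl | refl = refl

Rho6Shape-irrelevant : ∀ xs → Irrelevant (Rho6Shape xs)
Rho6Shape-irrelevant (ℓ ∷ rest) (a , b , c) (a′ , b′ , c′)
  with All.irrelevant ℕP.≤-irrelevant a a′ | All.irrelevant (λ {p} → IsUnit6-irrelevant {p}) b b′ | ℕP.≡-irrelevant c c′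
... | refl | refl | refl = refl

Rho6-≡ : ∀ {n} {a b : Rho6 n} → proj₁ a ≡ proj₁ b → a ≡ b
Rho6-≡ {a = xs , p , s} {b = .xs , p′ , s′} refl =
  cong₂ (λ p s → xs , p , s) (IsPartition-irrelevant p p′) (Rho6Shape-irrelevant xs s s′)

2*m≡m+m : ∀ m → 2 * m ≡ m + m
2*m≡m+m m = cong (_+_ m) (ℕP.+-identityʳ m)

Rho6-fromTail : ∀ {n p q qs} → let ps = p ∷ q ∷ qs in
                Linked _≥_ ps → All (T ∘ unit6) ps → 2 * sum ps ≡ n → Rho6 n
Rho6-fromTail {n} {p} {q} {qs} l us e = sum ps ∷ ps , partition , shape
  where
  ps = p ∷ q ∷ qs
  p≤s : p ≤ sum ps
  p≤s = ℕP.m≤m+n p (q + sum qs)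
  p<s : p < sum ps
  p<s = ℕP.m<m+n p (ℕP.≤-trans (ok⇒positive (All.head (All.tail us))) (ℕP.m≤m+n q (sum qs)))
  partition : IsPartition n (sum ps ∷ ps)
  partition = record
    { nonincreasing = p≤s ∷ l
    ; positive      = ℕP.≤-trans (ok⇒positive (All.head us)) p≤s ∷ All.map ok⇒positive us
    ; sums          = trans (sym (2*m≡m+m (sum ps))) e
    }
  shape : Rho6Shape (sum ps ∷ ps)
  shape = All.map (λ r≤p → ℕP.≤-<-trans r≤p p<s) (Linked⇒All (λ i≥j j≥k → ℕP.≤-trans j≥k i≥j) ℕP.≤-refl l)
        , All.map toWitness us
        , refl

Parts↔SinglePart⊎Rho6 : ∀ {B n} → n ≤ B → 1 ≤ n → Parts B n ↔ (SinglePart n ⊎ Rho6 n)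
Parts↔SinglePart⊎Rho6 {B} {n} n≤B 1≤n = mk↔ₛ′ to from to∘from from∘to
  where
  to : Parts B n → SinglePart n ⊎ Rho6 n
  to ([] , _ , _ , 0≡n) = ⊥-elim (ℕP.<-irrefl 0≡n 1≤n)
  to (p ∷ [] , _ , us , e) = inj₁ (p , All.head us , trans (cong (2 *_) (sym (ℕP.+-identityʳ p))) e)
  to (_ ∷ _ ∷ _ , l , us , e) = inj₂ (Rho6-fromTail (Linked.tail l) us e)
  from : SinglePart n ⊎ Rho6 n → Parts B n
  from (inj₁ (p , u , 2p≡n)) =
    p ∷ [] , ℕP.≤-trans (subst (p ≤_) 2p≡n (ℕP.m≤m+n p (p + 0))) n≤B ∷ [-] , u ∷ [] ,
    trans (cong (2 *_) (ℕP.+-identityʳ p)) 2p≡n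
  from (inj₂ ([] , _ , ()))
  from (inj₂ (ℓ ∷ rest , partition , _ , units , Σrest≡ℓ)) =
    rest , Linked-≥-headʳ ℓ≤B (IsPartition.nonincreasing partition) , All.map fromWitness units ,
    trans (2*m≡m+m (sum rest)) (trans (cong (_+ sum rest) Σrest≡ℓ) (IsPartition.sums partition))
    where
    ℓ≤B : ℓ ≤ B
    ℓ≤B = ℕP.≤-trans (subst (ℓ ≤_) (IsPartition.sums partition) (ℕP.m≤m+n ℓ (sum rest))) n≤B
  from∘to : ∀ a → from (to a) ≡ a
  from∘to ([] , _ , _ , 0≡n)    = ⊥-elim (ℕP.<-irrefl 0≡n 1≤n)
  from∘to (_ ∷ [] , _)         = Parts-≡ refl
  from∘to (_ ∷ _ ∷ _ , _)      = Parts-≡ refl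
  to∘from : ∀ b → to (from b) ≡ b
  to∘from (inj₁ _) = cong inj₁ (SinglePart-≡ refl)
  to∘from (inj₂ ([] , _ , ()))
  to∘from (inj₂ (ℓ ∷ [] , partition , _ , _ , 0≡ℓ)) with IsPartition.positive partition
  ... | 1≤ℓ ∷ _ = ⊥-elim (ℕP.<-irrefl 0≡ℓ 1≤ℓ)
  to∘from (inj₂ (ℓ ∷ p ∷ [] , _ , p<ℓ ∷ [] , _ , p+0≡ℓ)) =
    ⊥-elim (ℕP.<-irrefl (trans (sym (ℕP.+-identityʳ p)) p+0≡ℓ) p<ℓ)
  to∘from (inj₂ (ℓ ∷ rest@(_ ∷ _ ∷ _) , _ , _ , _ , Σrest≡ℓ)) = cong inj₂ (Rho6-≡ (cong (_∷ rest) Σrest≡ℓ))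

theorem6 : (n : ℕ) → 1 ≤ n →
    Σ ℕ (λ k → (rhs6 n ≡ + k) × (Rho6 n ↔ Fin k))
theorem6 n 1≤n = Counts-⊖ count-SinglePart⊎Rho6 (count-SinglePart n)
  where
  B = suc n * 6
  n≤B : n ≤ B
  n≤B = ℕP.≤-trans (ℕP.n≤1+n n) (ℕP.m≤m*n (suc n) 6)
  count-SinglePart⊎Rho6 : Counts (invPoch2 2 10 12 n) (SinglePart n ⊎ Rho6 n)
  count-SinglePart⊎Rho6 =
    Counts-cast (sym (invPoch2Trunc≡gen (suc n) n)) (Counts-↔ (Parts↔SinglePart⊎Rho6 n≤B 1≤n) (count B n))
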